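{- Let $x,y$ be nonzero complex numbers, fix a square root $\sqrt{xy}$, and set $c=\frac{1+xy}{2\sqrt{xy}}$; interpret $(xy^{ -1})^{m/2}$ as $(x/\sqrt{xy})^{m}$. Then for every integer $N\ge1$ and all integers $0\le j,k\le N$, \[ s_{(N,j)/(k)}(x,y^{ -1}) = (xy^{ -1})^{(N+j-k)/2}\,U_{\min(j,k)}(c)\,U_{N-\max(j,k)}(c) = \frac{1}{x^{k}y^{N+j}}\sum_{r=0}^{\min(j,k)}(xy)^{r}\sum_{r=\max(j,k)}^{N}(xy)^{r}. \]
   Context: $s_{(N,j)/(k)}$ is the skew Schur polynomial of shape $(N,j)/(k)$, evaluated at the two variables $x,y^{ -1}$. $U_n$ are the Chebyshev polynomials of the second kind: $U_0(z)=1$, $U_1(z)=2z$, $U_{n+1}(z)=2zU_n(z)-U_{n-1}(z)$. -}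

module Defs where

open import Level using (Level; _⊔_) renaming (suc to lsuc)
open import Algebra.Bundles using (CommutativeRing)
open import Data.Nat as ℕ using (ℕ; zero; suc; _∸_; _≤ᵇ_; _<ᵇ_)
open import Data.Bool using (Bool; true; false; if_then_else_; _∧_)
open import Relation.Nullary using (¬_)
import Relation.Binary.Reasoning.Setoid as SetoidReasoning

record Field (c ℓ : Level) : Set (lsuc (c ⊔ ℓ)) where
  field
    commutativeRing : CommutativeRing c ℓ
  open CommutativeRing commutativeRing public
  field
    inv      : (a : Carrier) → ¬ (a ≈ 0#) → Carrier
    inverse  : ∀ a (p : ¬ (a ≈ 0#)) → (a * inv a p) ≈ 1#
    0≉1      : ¬ (0# ≈ 1#)

module FieldOps {c ℓ : Level} (F : Field c ℓ) where
  open Field F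

  natCast : ℕ → Carrier
  natCast zero    = 0#
  natCast (suc n) = 1# + natCast n

  CharZero : Set ℓ
  CharZero = ∀ n → ¬ (natCast (suc n) ≈ 0#)

  two : Carrier
  two = natCast 2

  pow : Carrier → ℕ → Carrier
  pow a zero    = 1#
  pow a (suc n) = a * pow a n

  U : ℕ → Carrier → Carrier
  U zero          z = 1#
  U (suc zero)    z = two * z
  U (suc (suc n)) z = (two * z) * U (suc n) z - U n z

  sumFromTo : ℕ → ℕ → (ℕ → Carrier) → Carrier
  sumFromTo m zero    f = if m ≤ᵇ 0 then f 0 else 0#
  sumFromTo m (suc n) f =
    sumFromTo m n f + (if m ≤ᵇ suc n then f (suc n) else 0#)

  sumTo : ℕ → (ℕ → Carrier) → Carrier
  sumTo n f = sumFromTo 0 n f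

  -- Skew Schur polynomial s_{(N,j)/(k)}(u,v) in two variables u, v,
  -- as the generating function of semistandard Young tableaux of skew
  -- shape (N,j)/(k) with entries in {1,2}, weight u^{#1} v^{#2}.
  -- Row 1 occupies columns k+1..N, row 2 occupies columns 1..j.
  -- A weakly increasing row with entries in {1,2} is 1^a 2^(len-a);
  -- a = number of 1s in row 1 (0 ≤ a ≤ N-k), b = number of 1s in
  -- row 2 (0 ≤ b ≤ j).  Entries in column col:
  --   row 1:  1 if col ≤ k + a else 2,   row 2:  1 if col ≤ b else 2.
  -- Column-strictness: for every column col with k < col ≤ j (the columns
  -- containing a cell in both rows), entry(row1) < entry(row2).

  entry₁ : (k a col : ℕ) → ℕ
  entry₁ k a col = if col ≤ᵇ (k ℕ.+ a) then 1 else 2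

  entry₂ : (b col : ℕ) → ℕ
  entry₂ b col = if col ≤ᵇ b then 1 else 2

  columnsOK : (k a b m : ℕ) → Bool
  columnsOK k a b zero    = true
  columnsOK k a b (suc m) =
    columnsOK k a b m ∧
    (if k <ᵇ suc m then entry₁ k a (suc m) <ᵇ entry₂ b (suc m) else true)

  isSSYT : (j k a b : ℕ) → Bool
  isSSYT j k a b = columnsOK k a b j

  skewSchur : (N j k : ℕ) → Carrier → Carrier → Carrier
  skewSchur N j k u v =
    sumTo (N ∸ k) λ a → sumTo j λ b →
      if isSSYT j k a b
        then pow u (a ℕ.+ b) * pow v ((N ∸ k ∸ a) ℕ.+ (j ∸ b))
        else 0#

  sqrt≉0 : ∀ {x y s} → ¬ (x ≈ 0#) → (hy : ¬ (y ≈ 0#)) →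
           (s * s) ≈ (x * y) → ¬ (s ≈ 0#)
  sqrt≉0 {x} {y} {s} hx hy hs s≈0 = hx x≈0
    where
    open SetoidReasoning setoid
    xy≈0 : (x * y) ≈ 0#
    xy≈0 = begin
      x * y   ≈⟨ sym hs ⟩
      s * s   ≈⟨ *-cong s≈0 refl ⟩
      0# * s  ≈⟨ zeroˡ s ⟩
      0#      ∎
    x≈0 : x ≈ 0#
    x≈0 = begin
      x                  ≈⟨ sym (*-identityʳ x) ⟩
      x * 1#             ≈⟨ *-cong refl (sym (inverse y hy)) ⟩
      x * (y * inv y hy) ≈⟨ sym (*-assoc x y (inv y hy)) ⟩
      (x * y) * inv y hy ≈⟨ *-cong xy≈0 refl ⟩
      0# * inv y hy      ≈⟨ zeroˡ (inv y hy) ⟩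
      0#                 ∎

-- A semistandard filling of (N,j)/(k) by 1 < 2 is fixed by the numbers a and b of 1s in its two
-- rows, and column-strictness says exactly that a ≥ j − k and b ≤ min(j,k). The sum over tableaux
-- therefore splits into a product of two sums of monomials xⁱ y^{i−n}, each a power of y⁻¹ times a
-- geometric sum in w = xy; this is the second formula. The first one follows from
-- U_n(c) = (xy)^{−n/2} (1 + w + ⋯ + wⁿ), which holds because the right-hand side satisfies the
-- Chebyshev recurrence: (1 + w)(1 + ⋯ + w^{n+1}) = (1 + ⋯ + w^{n+2}) + w (1 + ⋯ + wⁿ).

module Submission where

open import Defs
open import Level using (Level)
import Data.Nat as ℕ
open import Data.Nat using (ℕ; _≤_; _∸_; _⊓_; _⊔_)
open import Data.Product using (_×_)
open import Relation.Nullary using (¬_)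

open import Data.Nat using (zero; suc; _<_; _≤ᵇ_; _<ᵇ_; z≤n)
import Data.Nat.Properties as ℕₚ
open import Data.Nat.Solver using (module +-*-Solver)
open import Data.Bool using (Bool; true; false; T; if_then_else_; _∧_)
open import Data.Bool.Properties using (T-∧)
open import Data.Empty using (⊥-elim)
open import Data.Product using (_,_; proj₁; proj₂)
open import Data.Sum using (inj₁; inj₂)
open import Function.Bundles using (Equivalence)
open import Relation.Binary.PropositionalEquality as ≡ using (_≡_)
open import Relation.Nullary.Reflects using (ofʸ; ofⁿ)
import Relation.Binary.Reasoning.Setoid as SetoidReasoning

T-injective : ∀ {p q : Bool} → (T p → T q) → (T q → T p) → p ≡ q
T-injective {false} {false} _ _ = ≡.refl
T-injective {false} {true}  _ g = ⊥-elim (g _)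
T-injective {true}  {false} f _ = ⊥-elim (f _)
T-injective {true}  {true}  _ _ = ≡.refl

T-if : ∀ {b p} → T b → T (if b then p else true) → T p
T-if {true} _ t = t

module Naturals where
  open import Data.Nat using (_+_)
  open ≡.≡-Reasoning

  ≤ᵇ-true : ∀ {m n} → m ≤ n → (m ≤ᵇ n) ≡ true
  ≤ᵇ-true {m} {n} m≤n with m ≤ᵇ n | ℕₚ.≤ᵇ-reflects-≤ m n
  ... | true  | _       = ≡.refl
  ... | false | ofⁿ m≰n = ⊥-elim (m≰n m≤n)

  ≤ᵇ-false : ∀ {m n} → n < m → (m ≤ᵇ n) ≡ false
  ≤ᵇ-false {m} {n} n<m with m ≤ᵇ n | ℕₚ.≤ᵇ-reflects-≤ m n
  ... | false | _       = ≡.refl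
  ... | true  | ofʸ m≤n = ⊥-elim (ℕₚ.<⇒≱ n<m m≤n)

  m⊔n≡n+[m∸n] : ∀ m n → m ⊔ n ≡ n + (m ∸ n)
  m⊔n≡n+[m∸n] zero    n       = ≡.sym (≡.trans (≡.cong (n +_) (ℕₚ.0∸n≡0 n)) (ℕₚ.+-identityʳ n))
  m⊔n≡n+[m∸n] (suc m) zero    = ≡.refl
  m⊔n≡n+[m∸n] (suc m) (suc n) = ≡.cong suc (m⊔n≡n+[m∸n] m n)

  [m+o]∸[n+o]≡m∸n : ∀ m n o → (m + o) ∸ (n + o) ≡ m ∸ n
  [m+o]∸[n+o]≡m∸n m n o =
    ≡.trans (≡.cong₂ _∸_ (ℕₚ.+-comm m o) (ℕₚ.+-comm n o)) (ℕₚ.[m+n]∸[m+o]≡n∸o o m n)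

  module Shape {N j k : ℕ} (j≤N : j ≤ N) (k≤N : k ≤ N) where
    open +-*-Solver using (solve; _:+_; _:=_)

    d p M K : ℕ
    d = j ∸ k
    p = j ⊓ k
    M = N ∸ (j ⊔ k)
    K = M + j

    p+d≡j : p + d ≡ j
    p+d≡j = ≡.trans (≡.cong (_+ d) (ℕₚ.⊓-comm j k)) (ℕₚ.m⊓n+n∸m≡n k j)

    N≡M+[j⊔k] : N ≡ M + (j ⊔ k)
    N≡M+[j⊔k] = ≡.sym (ℕₚ.m∸n+n≡m (ℕₚ.⊔-lub j≤N k≤N))

    N+j≡K+[j⊔k] : N + j ≡ K + (j ⊔ k)
    N+j≡K+[j⊔k] = begin
      N + j             ≡⟨ ≡.cong (_+ j) N≡M+[j⊔k] ⟩
      M + (j ⊔ k) + j   ≡⟨ solve 3 (λ M m j → M :+ m :+ j := M :+ j :+ m) ≡.refl M (j ⊔ k) j ⟩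
      K + (j ⊔ k)       ∎

    N∸k≡M+d : N ∸ k ≡ M + d
    N∸k≡M+d = begin
      N ∸ k             ≡⟨ ≡.cong (_∸ k) N≡M+[j⊔k] ⟩
      M + (j ⊔ k) ∸ k   ≡⟨ ≡.cong (λ m → M + m ∸ k) (m⊔n≡n+[m∸n] j k) ⟩
      M + (k + d) ∸ k   ≡⟨ ≡.cong (_∸ k) (solve 3 (λ M k d → M :+ (k :+ d) := k :+ (M :+ d))
                                                   ≡.refl M k d) ⟩
      k + (M + d) ∸ k   ≡⟨ ℕₚ.m+n∸m≡n k (M + d) ⟩
      M + d             ∎

    N+j∸k≡d+K : N + j ∸ k ≡ d + K
    N+j∸k≡d+K = begin
      N + j ∸ k         ≡⟨ ℕₚ.+-∸-comm j k≤N ⟩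
      (N ∸ k) + j       ≡⟨ ≡.cong (_+ j) N∸k≡M+d ⟩
      M + d + j         ≡⟨ solve 3 (λ M d j → M :+ d :+ j := d :+ (M :+ j)) ≡.refl M d j ⟩
      d + K             ∎

    d+p+M≡K : d + p + M ≡ K
    d+p+M≡K = begin
      d + p + M         ≡⟨ ≡.cong (_+ M) (ℕₚ.+-comm d p) ⟩
      p + d + M         ≡⟨ ≡.cong (_+ M) p+d≡j ⟩
      j + M             ≡⟨ ℕₚ.+-comm j M ⟩
      K                 ∎

open Naturals

module Tableaux {c ℓ : Level} (F : Field c ℓ) where
  open FieldOps F
  open import Data.Nat using (_+_)

  entries-sound : ∀ {k a b col} → T (entry₁ k a col <ᵇ entry₂ b col) → col ≤ k + a × b < col
  entries-sound {k} {a} {b} {col} increase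
    with col ≤ᵇ k + a | ℕₚ.≤ᵇ-reflects-≤ col (k + a) | col ≤ᵇ b | ℕₚ.≤ᵇ-reflects-≤ col b
  ... | true  | ofʸ col≤k+a | false | ofⁿ col≰b = col≤k+a , ℕₚ.≰⇒> col≰b
  ... | true  | _           | true  | _         = ⊥-elim increase
  ... | false | _           | true  | _         = ⊥-elim increase
  ... | false | _           | false | _         = ⊥-elim increase

  entries-complete : ∀ {k a b col} → col ≤ k + a → b < col → T (entry₁ k a col <ᵇ entry₂ b col)
  entries-complete col≤k+a b<col rewrite ≤ᵇ-true col≤k+a | ≤ᵇ-false b<col = _

  columnsOK-sound : ∀ {k a b m col} → T (columnsOK k a b m) → k < col → col ≤ m →
                    col ≤ k + a × b < col
  columnsOK-sound {m = zero} _ () z≤n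
  columnsOK-sound {k} {a} {b} {suc m} {col} ok k<col col≤1+m
    with Equivalence.to (T-∧ {columnsOK k a b m}) ok | ℕₚ.m≤n⇒m<n∨m≡n col≤1+m
  ... | earlier , _   | inj₁ col<1+m = columnsOK-sound earlier k<col (ℕₚ.≤-pred col<1+m)
  ... | _       , new | inj₂ ≡.refl  = entries-sound {k} {a} (T-if (ℕₚ.<⇒<ᵇ k<col) new)

  columnsOK-complete : ∀ {k a b m} → m ≤ k + a → b ≤ k → T (columnsOK k a b m)
  columnsOK-complete {m = zero}              _       _   = _
  columnsOK-complete {k} {a} {b} {suc m} m<k+a b≤k =
    Equivalence.from T-∧ (columnsOK-complete {k} {a} (ℕₚ.<⇒≤ m<k+a) b≤k , newColumn)
    where
    newColumn : T (if k <ᵇ suc m then entry₁ k a (suc m) <ᵇ entry₂ b (suc m) else true)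
    newColumn with k <ᵇ suc m | ℕₚ.<ᵇ-reflects-< k (suc m)
    ... | false | _        = _
    ... | true  | ofʸ k<col = entries-complete {k} {a} m<k+a (ℕₚ.≤-<-trans b≤k k<col)

  -- Only the columns k+1 and j carry information: the first forces b ≤ k, the last j ≤ k + a.
  isSSYT≡ : ∀ {j k a b} → b ≤ j → isSSYT j k a b ≡ ((j ∸ k ≤ᵇ a) ∧ (b ≤ᵇ k))
  isSSYT≡ {j} {k} {a} {b} b≤j = T-injective sound complete
    where
    shape : T (isSSYT j k a b) → j ≤ k + a × b ≤ k
    shape ok with ℕₚ.<-≤-connex k j
    ... | inj₁ k<j = proj₁ (columnsOK-sound ok k<j ℕₚ.≤-refl)
                   , ℕₚ.≤-pred (proj₂ (columnsOK-sound ok ℕₚ.≤-refl k<j))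
    ... | inj₂ j≤k = ℕₚ.≤-trans j≤k (ℕₚ.m≤m+n k a) , ℕₚ.≤-trans b≤j j≤k

    sound : T (isSSYT j k a b) → T ((j ∸ k ≤ᵇ a) ∧ (b ≤ᵇ k))
    sound ok = let j≤k+a , b≤k = shape ok in
      Equivalence.from T-∧ (ℕₚ.≤⇒≤ᵇ (ℕₚ.m≤n+o⇒m∸n≤o j k j≤k+a) , ℕₚ.≤⇒≤ᵇ b≤k)

    complete : T ((j ∸ k ≤ᵇ a) ∧ (b ≤ᵇ k)) → T (isSSYT j k a b)
    complete t = let j∸k≤a , b≤k = Equivalence.to (T-∧ {j ∸ k ≤ᵇ a}) t in
      columnsOK-complete {k} {a}
        (ℕₚ.≤-trans (ℕₚ.m≤n+m∸n j k) (ℕₚ.+-monoʳ-≤ k (ℕₚ.≤ᵇ⇒≤ (j ∸ k) a j∸k≤a)))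
        (ℕₚ.≤ᵇ⇒≤ b k b≤k)

module PowersAndSums {c ℓ : Level} (F : Field c ℓ) where
  open Field F hiding (zero)
  open FieldOps F
  open Tableaux F using (isSSYT≡)
  open import Algebra.Solver.Ring.NaturalCoefficients.Default commutativeSemiring
    using (solve; _:+_; _:*_; _:=_; con)
  open import Algebra.Properties.CommutativeSemigroup *-commutativeSemigroup using (interchange)
  open import Algebra.Properties.Group +-group using (//-rightDividesʳ)
  open SetoidReasoning setoid

  pow-≡ : ∀ a {m n} → m ≡ n → pow a m ≈ pow a n
  pow-≡ a ≡.refl = refl

  pow-cong : ∀ {a b} n → a ≈ b → pow a n ≈ pow b n
  pow-cong zero    _   = refl
  pow-cong (suc n) a≈b = *-cong a≈b (pow-cong n a≈b)

  pow-distribˡ-+-* : ∀ a m n → pow a (m ℕ.+ n) ≈ pow a m * pow a n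
  pow-distribˡ-+-* a zero    n = sym (*-identityˡ _)
  pow-distribˡ-+-* a (suc m) n =
    trans (*-cong refl (pow-distribˡ-+-* a m n)) (sym (*-assoc _ _ _))

  pow-distrib-* : ∀ a b n → pow (a * b) n ≈ pow a n * pow b n
  pow-distrib-* a b zero    = sym (*-identityˡ _)
  pow-distrib-* a b (suc n) = trans (*-cong refl (pow-distrib-* a b n)) (interchange _ _ _ _)

  pow-1# : ∀ n → pow 1# n ≈ 1#
  pow-1# zero    = refl
  pow-1# (suc n) = trans (*-identityˡ _) (pow-1# n)

  pow-inverse : ∀ {a b} n → a * b ≈ 1# → pow a n * pow b n ≈ 1#
  pow-inverse {a} {b} n ab≈1 =
    trans (sym (pow-distrib-* a b n)) (trans (pow-cong n ab≈1) (pow-1# n))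

  sumTo-≡ : ∀ {m n} (f : ℕ → Carrier) → m ≡ n → sumTo m f ≈ sumTo n f
  sumTo-≡ f ≡.refl = refl

  sumTo-cong : ∀ n {f g : ℕ → Carrier} → (∀ i → i ≤ n → f i ≈ g i) → sumTo n f ≈ sumTo n g
  sumTo-cong zero    f≈g = f≈g 0 z≤n
  sumTo-cong (suc n) f≈g =
    +-cong (sumTo-cong n (λ i i≤n → f≈g i (ℕₚ.m≤n⇒m≤1+n i≤n))) (f≈g (suc n) ℕₚ.≤-refl)

  *-distribˡ-sumTo : ∀ n a (f : ℕ → Carrier) → a * sumTo n f ≈ sumTo n (λ i → a * f i)
  *-distribˡ-sumTo zero    a f = refl
  *-distribˡ-sumTo (suc n) a f = trans (distribˡ a _ _) (+-cong (*-distribˡ-sumTo n a f) refl)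

  *-distribʳ-sumTo : ∀ n a (f : ℕ → Carrier) → sumTo n f * a ≈ sumTo n (λ i → f i * a)
  *-distribʳ-sumTo zero    a f = refl
  *-distribʳ-sumTo (suc n) a f = trans (distribʳ a _ _) (+-cong (*-distribʳ-sumTo n a f) refl)

  sumTo-*-sumTo : ∀ m n (f g : ℕ → Carrier) →
                  sumTo m f * sumTo n g ≈ sumTo m (λ a → sumTo n (λ b → f a * g b))
  sumTo-*-sumTo m n f g =
    trans (*-distribʳ-sumTo m _ f) (sumTo-cong m (λ a _ → *-distribˡ-sumTo n (f a) g))

  sumFromTo≈sumTo-if : ∀ m n (f : ℕ → Carrier) →
                       sumFromTo m n f ≈ sumTo n (λ i → if m ≤ᵇ i then f i else 0#)
  sumFromTo≈sumTo-if m zero    f = refl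
  sumFromTo≈sumTo-if m (suc n) f = +-cong (sumFromTo≈sumTo-if m n f) refl

  sumFromTo-empty : ∀ m n (f : ℕ → Carrier) → n < m → sumFromTo m n f ≈ 0#
  sumFromTo-empty m zero    f n<m rewrite ≤ᵇ-false n<m = refl
  sumFromTo-empty m (suc n) f n<m rewrite ≤ᵇ-false n<m =
    trans (+-identityʳ _) (sumFromTo-empty m n f (ℕₚ.<-trans (ℕₚ.n<1+n n) n<m))

  sumFromTo-diagonal : ∀ m (f : ℕ → Carrier) → sumFromTo m m f ≈ f m
  sumFromTo-diagonal zero    f = refl
  sumFromTo-diagonal (suc m) f rewrite ≤ᵇ-true (ℕₚ.≤-refl {suc m}) =
    trans (+-cong (sumFromTo-empty (suc m) m f ℕₚ.≤-refl) refl) (+-identityˡ _)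

  sumFromTo-shift : ∀ m n (f : ℕ → Carrier) →
                    sumFromTo m (n ℕ.+ m) f ≈ sumTo n (λ i → f (i ℕ.+ m))
  sumFromTo-shift m zero    f = sumFromTo-diagonal m f
  sumFromTo-shift m (suc n) f rewrite ≤ᵇ-true (ℕₚ.m≤n+m m (suc n)) =
    +-cong (sumFromTo-shift m n f) refl

  sumTo-if-≤ : ∀ n k (f : ℕ → Carrier) →
               sumTo n (λ b → if b ≤ᵇ k then f b else 0#) ≈ sumTo (n ⊓ k) f
  sumTo-if-≤ zero    k f = refl
  sumTo-if-≤ (suc n) k f with ℕₚ.≤-<-connex (suc n) k
  ... | inj₁ n<k rewrite ≤ᵇ-true n<k | ℕₚ.m≤n⇒m⊓n≡m n<k =
    +-cong (trans (sumTo-if-≤ n k f) (sumTo-≡ f (ℕₚ.m≤n⇒m⊓n≡m (ℕₚ.<⇒≤ n<k)))) refl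
  ... | inj₂ k<1+n rewrite ≤ᵇ-false k<1+n | ℕₚ.m≥n⇒m⊓n≡n (ℕₚ.<⇒≤ k<1+n) =
    trans (+-identityʳ _)
          (trans (sumTo-if-≤ n k f) (sumTo-≡ f (ℕₚ.m≥n⇒m⊓n≡n (ℕₚ.≤-pred k<1+n))))

  if-∧-* : ∀ p q {t u v} → t ≈ u * v →
           (if p ∧ q then t else 0#) ≈ (if p then u else 0#) * (if q then v else 0#)
  if-∧-* true  true  t≈uv = t≈uv
  if-∧-* true  false _    = sym (zeroʳ _)
  if-∧-* false q     _    = sym (zeroˡ _)

  skewSchur-factorisation : ∀ N j k u v →
    skewSchur N j k u v ≈ sumFromTo (j ∸ k) (N ∸ k) (λ a → pow u a * pow v (N ∸ k ∸ a))
                        * sumTo (j ⊓ k) (λ b → pow u b * pow v (j ∸ b))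
  skewSchur-factorisation N j k u v = begin
    skewSchur N j k u v
      ≈⟨ sumTo-cong (N ∸ k) (λ a _ → sumTo-cong j (λ b b≤j → tableau a b b≤j)) ⟩
    sumTo (N ∸ k) (λ a → sumTo j (λ b → row₁ a * row₂ b))
      ≈⟨ sumTo-*-sumTo (N ∸ k) j row₁ row₂ ⟨
    sumTo (N ∸ k) row₁ * sumTo j row₂
      ≈⟨ *-cong (sym (sumFromTo≈sumTo-if (j ∸ k) (N ∸ k) A)) (sumTo-if-≤ j k B) ⟩
    sumFromTo (j ∸ k) (N ∸ k) A * sumTo (j ⊓ k) B ∎
    where
    A B row₁ row₂ : ℕ → Carrier
    A a = pow u a * pow v (N ∸ k ∸ a)
    B b = pow u b * pow v (j ∸ b)
    row₁ a = if j ∸ k ≤ᵇ a then A a else 0#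
    row₂ b = if b ≤ᵇ k then B b else 0#

    tableau : ∀ a b → b ≤ j →
      (if isSSYT j k a b then pow u (a ℕ.+ b) * pow v ((N ∸ k ∸ a) ℕ.+ (j ∸ b)) else 0#)
        ≈ row₁ a * row₂ b
    tableau a b b≤j rewrite isSSYT≡ {j} {k} {a} {b} b≤j =
      if-∧-* (j ∸ k ≤ᵇ a) (b ≤ᵇ k)
        (trans (*-cong (pow-distribˡ-+-* u a b) (pow-distribˡ-+-* v (N ∸ k ∸ a) (j ∸ b)))
               (interchange _ _ _ _))

  sumTo-homogeneous : ∀ {x y Y} → y * Y ≈ 1# → ∀ {m n} → m ≤ n →
    sumTo m (λ i → pow x i * pow Y (n ∸ i)) ≈ pow Y n * sumTo m (pow (x * y))
  sumTo-homogeneous {x} {y} {Y} yY≈1 {m} {n} m≤n =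
    trans (sumTo-cong m (λ i i≤m → term i (ℕₚ.≤-trans i≤m m≤n)))
          (sym (*-distribˡ-sumTo m (pow Y n) (pow (x * y))))
    where
    term : ∀ i → i ≤ n → pow x i * pow Y (n ∸ i) ≈ pow Y n * pow (x * y) i
    term i i≤n = begin
      pow x i * pow Y (n ∸ i)
        ≈⟨ *-identityʳ _ ⟨
      (pow x i * pow Y (n ∸ i)) * 1#
        ≈⟨ *-cong refl (pow-inverse i yY≈1) ⟨
      (pow x i * pow Y (n ∸ i)) * (pow y i * pow Y i)
        ≈⟨ solve 4 (λ a b c d → (c :* a) :* (d :* b) := (a :* b) :* (c :* d)) refl
             (pow Y (n ∸ i)) (pow Y i) (pow x i) (pow y i) ⟩
      (pow Y (n ∸ i) * pow Y i) * (pow x i * pow y i)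
        ≈⟨ *-cong (pow-distribˡ-+-* Y (n ∸ i) i) (pow-distrib-* x y i) ⟨
      pow Y ((n ∸ i) ℕ.+ i) * pow (x * y) i
        ≈⟨ *-cong (pow-≡ Y (ℕₚ.m∸n+n≡m i≤n)) refl ⟩
      pow Y n * pow (x * y) i ∎

  sumFromTo-homogeneous : ∀ {x y Y} → y * Y ≈ 1# → ∀ l n →
    sumFromTo l (n ℕ.+ l) (λ a → pow x a * pow Y (n ℕ.+ l ∸ a))
      ≈ pow x l * (pow Y n * sumTo n (pow (x * y)))
  sumFromTo-homogeneous {x} {y} {Y} yY≈1 l n = begin
    sumFromTo l (n ℕ.+ l) (λ a → pow x a * pow Y (n ℕ.+ l ∸ a))
      ≈⟨ sumFromTo-shift l n _ ⟩
    sumTo n (λ i → pow x (i ℕ.+ l) * pow Y (n ℕ.+ l ∸ (i ℕ.+ l)))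
      ≈⟨ sumTo-cong n (λ i _ → term i) ⟩
    sumTo n (λ i → pow x l * (pow x i * pow Y (n ∸ i)))
      ≈⟨ *-distribˡ-sumTo n (pow x l) _ ⟨
    pow x l * sumTo n (λ i → pow x i * pow Y (n ∸ i))
      ≈⟨ *-cong refl (sumTo-homogeneous {x} yY≈1 (ℕₚ.≤-refl {n})) ⟩
    pow x l * (pow Y n * sumTo n (pow (x * y))) ∎
    where
    term : ∀ i → pow x (i ℕ.+ l) * pow Y (n ℕ.+ l ∸ (i ℕ.+ l)) ≈ pow x l * (pow x i * pow Y (n ∸ i))
    term i = trans (*-cong (pow-distribˡ-+-* x i l) (pow-≡ Y ([m+o]∸[n+o]≡m∸n n i l)))
                   (trans (*-cong (*-comm _ _) refl) (*-assoc _ _ _))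

  sumFromTo-pow : ∀ w l n → sumFromTo l (n ℕ.+ l) (pow w) ≈ sumTo n (pow w) * pow w l
  sumFromTo-pow w l n = begin
    sumFromTo l (n ℕ.+ l) (pow w)            ≈⟨ sumFromTo-shift l n (pow w) ⟩
    sumTo n (λ i → pow w (i ℕ.+ l))          ≈⟨ sumTo-cong n (λ i _ → pow-distribˡ-+-* w i l) ⟩
    sumTo n (λ i → pow w i * pow w l)        ≈⟨ *-distribʳ-sumTo n (pow w l) (pow w) ⟨
    sumTo n (pow w) * pow w l                ∎

  sumTo-pow-step : ∀ w n →
    (1# + w) * sumTo (suc n) (pow w) ≈ sumTo (suc (suc n)) (pow w) + w * sumTo n (pow w)
  sumTo-pow-step w n =
    solve 3 (λ w g q → (con 1 :+ w) :* (g :+ q) := ((g :+ q) :+ w :* q) :+ w :* g) refl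
      w (sumTo n (pow w)) (pow w (suc n))

  U-step : ∀ {z S w} → two * z ≈ (1# + w) * S → S * (S * w) ≈ 1# → ∀ n →
           U n z ≈ pow S n * sumTo n (pow w) →
           U (suc n) z ≈ pow S (suc n) * sumTo (suc n) (pow w) →
           U (suc (suc n)) z ≈ pow S (suc (suc n)) * sumTo (suc (suc n)) (pow w)
  U-step {z} {S} {w} 2z≈ SSw≈1 n Uₙ Uₙ₊₁ =
    trans (+-cong recurrence refl) (//-rightDividesʳ (U n z) _)
    where
    G : ℕ → Carrier
    G m = sumTo m (pow w)

    recurrence : two * z * U (suc n) z ≈ pow S (suc (suc n)) * G (suc (suc n)) + U n z
    recurrence = begin
      two * z * U (suc n) z
        ≈⟨ *-cong 2z≈ Uₙ₊₁ ⟩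
      (1# + w) * S * (S * pow S n * G (suc n))
        ≈⟨ solve 4 (λ o S p g → o :* S :* (S :* p :* g) := S :* (S :* p) :* (o :* g)) refl
             (1# + w) S (pow S n) (G (suc n)) ⟩
      pow S (suc (suc n)) * ((1# + w) * G (suc n))
        ≈⟨ *-cong refl (sumTo-pow-step w n) ⟩
      pow S (suc (suc n)) * (G (suc (suc n)) + w * G n)
        ≈⟨ distribˡ _ _ _ ⟩
      pow S (suc (suc n)) * G (suc (suc n)) + S * (S * pow S n) * (w * G n)
        ≈⟨ +-cong refl (solve 4 (λ S p w g → S :* (S :* p) :* (w :* g) := S :* (S :* w) :* (p :* g))
                          refl S (pow S n) w (G n)) ⟩
      pow S (suc (suc n)) * G (suc (suc n)) + S * (S * w) * (pow S n * G n)
        ≈⟨ +-cong refl (trans (*-cong SSw≈1 (sym Uₙ)) (*-identityˡ _)) ⟩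
      pow S (suc (suc n)) * G (suc (suc n)) + U n z ∎

  U-geometric : ∀ {z S w} → two * z ≈ (1# + w) * S → S * (S * w) ≈ 1# →
                ∀ n → U n z ≈ pow S n * sumTo n (pow w)
  U-geometric _ _ zero = sym (*-identityˡ 1#)
  U-geometric {z} {S} {w} 2z≈ _ (suc zero) =
    trans 2z≈ (solve 2 (λ w S → (con 1 :+ w) :* S := (S :* con 1) :* (con 1 :+ w :* con 1))
                       refl w S)
  U-geometric 2z≈ SSw≈1 (suc (suc n)) =
    U-step 2z≈ SSw≈1 n (U-geometric 2z≈ SSw≈1 n) (U-geometric 2z≈ SSw≈1 (suc n))

module Evaluation {c ℓ : Level} (F : Field c ℓ) where
  open Field F hiding (zero)
  open FieldOps F
  open PowersAndSums F
  open SetoidReasoning setoid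
  open import Algebra.Solver.Ring.NaturalCoefficients.Default commutativeSemiring
    using (solve; _:*_; _:=_)

  module AtPoint (ch : CharZero) (x y : Carrier) (hx : ¬ (x ≈ 0#)) (hy : ¬ (y ≈ 0#))
                 (s : Carrier) (hs : s * s ≈ x * y) where

    X Y S w c₀ : Carrier
    X = inv x hx
    Y = inv y hy
    S = inv s (sqrt≉0 hx hy hs)
    w = x * y
    c₀ = (1# + (x * y)) * inv two (ch 1) * S

    G : ℕ → Carrier
    G n = sumTo n (pow w)

    xX≈1 : x * X ≈ 1#
    xX≈1 = inverse x hx

    yY≈1 : y * Y ≈ 1#
    yY≈1 = inverse y hy

    S*[S*w]≈1 : S * (S * w) ≈ 1#
    S*[S*w]≈1 = begin
      S * (S * w)        ≈⟨ *-cong refl (*-cong refl (sym hs)) ⟩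
      S * (S * (s * s))  ≈⟨ solve 2 (λ S s → S :* (S :* (s :* s)) := (s :* S) :* (s :* S)) refl S s ⟩
      (s * S) * (s * S)  ≈⟨ *-cong (inverse s _) (inverse s _) ⟩
      1# * 1#            ≈⟨ *-identityʳ 1# ⟩
      1#                 ∎

    two*c₀≈[1+w]*S : two * c₀ ≈ (1# + w) * S
    two*c₀≈[1+w]*S = begin
      two * c₀
        ≈⟨ solve 4 (λ t a i S → t :* ((a :* i) :* S) := (a :* S) :* (t :* i)) refl
             two (1# + w) (inv two (ch 1)) S ⟩
      (1# + w) * S * (two * inv two (ch 1))
        ≈⟨ *-cong refl (inverse two (ch 1)) ⟩
      (1# + w) * S * 1#
        ≈⟨ *-identityʳ _ ⟩
      (1# + w) * S ∎

    x*S*S≈Y : x * S * S ≈ Y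
    x*S*S≈Y = begin
      x * S * S            ≈⟨ *-identityˡ _ ⟨
      1# * (x * S * S)     ≈⟨ *-cong (sym yY≈1) refl ⟩
      y * Y * (x * S * S)  ≈⟨ solve 4 (λ x y Y S → y :* Y :* (x :* S :* S) := S :* (S :* (x :* y)) :* Y)
                                refl x y Y S ⟩
      S * (S * w) * Y      ≈⟨ *-cong S*[S*w]≈1 refl ⟩
      1# * Y               ≈⟨ *-identityˡ Y ⟩
      Y                    ∎

    U-c₀ : ∀ n → U n c₀ ≈ pow S n * G n
    U-c₀ = U-geometric two*c₀≈[1+w]*S S*[S*w]≈1

    module ForShape {N j k : ℕ} (j≤N : j ≤ N) (k≤N : k ≤ N) where
      open Shape j≤N k≤N

      normalForm : Carrier
      normalForm = pow x d * pow Y K * (G p * G M)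

      skewSchur≈normalForm : skewSchur N j k x Y ≈ normalForm
      skewSchur≈normalForm = begin
        skewSchur N j k x Y
          ≈⟨ skewSchur-factorisation N j k x Y ⟩
        row₁ (N ∸ k) * row₂
          ≈⟨ *-cong (reflexive (≡.cong row₁ N∸k≡M+d)) refl ⟩
        row₁ (M ℕ.+ d) * row₂
          ≈⟨ *-cong (sumFromTo-homogeneous yY≈1 d M) (sumTo-homogeneous yY≈1 (ℕₚ.m⊓n≤m j k)) ⟩
        pow x d * (pow Y M * G M) * (pow Y j * G p)
          ≈⟨ solve 5 (λ a b c e f → a :* (b :* c) :* (e :* f) := a :* (b :* e) :* (f :* c)) refl
               (pow x d) (pow Y M) (G M) (pow Y j) (G p) ⟩
        pow x d * (pow Y M * pow Y j) * (G p * G M)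
          ≈⟨ *-cong (*-cong refl (pow-distribˡ-+-* Y M j)) refl ⟨
        normalForm ∎
        where
        row₁ : ℕ → Carrier
        row₁ n = sumFromTo d n (λ a → pow x a * pow Y (n ∸ a))
        row₂ : Carrier
        row₂ = sumTo p (λ b → pow x b * pow Y (j ∸ b))

      chebyshevForm≈normalForm : pow (x * S) (N ℕ.+ j ∸ k) * U p c₀ * U M c₀ ≈ normalForm
      chebyshevForm≈normalForm = begin
        pow (x * S) (N ℕ.+ j ∸ k) * U p c₀ * U M c₀
          ≈⟨ *-cong (*-cong (pow-≡ (x * S) N+j∸k≡d+K) (U-c₀ p)) (U-c₀ M) ⟩
        pow (x * S) (d ℕ.+ K) * (pow S p * G p) * (pow S M * G M)
          ≈⟨ solve 5 (λ e a g b h → e :* (a :* g) :* (b :* h) := e :* (a :* b) :* (g :* h)) refl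
               (pow (x * S) (d ℕ.+ K)) (pow S p) (G p) (pow S M) (G M) ⟩
        pow (x * S) (d ℕ.+ K) * (pow S p * pow S M) * (G p * G M)
          ≈⟨ *-cong scaling refl ⟩
        normalForm ∎
        where
        S-exponents : pow S d * pow S p * pow S M ≈ pow S K
        S-exponents = begin
          pow S d * pow S p * pow S M   ≈⟨ *-cong (pow-distribˡ-+-* S d p) refl ⟨
          pow S (d ℕ.+ p) * pow S M     ≈⟨ pow-distribˡ-+-* S (d ℕ.+ p) M ⟨
          pow S (d ℕ.+ p ℕ.+ M)         ≈⟨ pow-≡ S d+p+M≡K ⟩
          pow S K                       ∎

        scaling : pow (x * S) (d ℕ.+ K) * (pow S p * pow S M) ≈ pow x d * pow Y K
        scaling = begin
          pow (x * S) (d ℕ.+ K) * (pow S p * pow S M)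
            ≈⟨ *-cong (trans (pow-distribˡ-+-* (x * S) d K) (*-cong (pow-distrib-* x S d) refl)) refl ⟩
          pow x d * pow S d * pow (x * S) K * (pow S p * pow S M)
            ≈⟨ solve 5 (λ a b c e f → a :* b :* c :* (e :* f) := a :* (c :* (b :* e :* f))) refl
                 (pow x d) (pow S d) (pow (x * S) K) (pow S p) (pow S M) ⟩
          pow x d * (pow (x * S) K * (pow S d * pow S p * pow S M))
            ≈⟨ *-cong refl (*-cong refl S-exponents) ⟩
          pow x d * (pow (x * S) K * pow S K)
            ≈⟨ *-cong refl (trans (sym (pow-distrib-* (x * S) S K)) (pow-cong K x*S*S≈Y)) ⟩
          pow x d * pow Y K ∎

      sumForm≈normalForm :
        pow X k * pow Y (N ℕ.+ j) * (G p * sumFromTo (j ⊔ k) N (pow w)) ≈ normalForm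
      sumForm≈normalForm = begin
        pow X k * pow Y (N ℕ.+ j) * (G p * sumFromTo (j ⊔ k) N (pow w))
          ≈⟨ *-cong refl (*-cong refl tail) ⟩
        pow X k * pow Y (N ℕ.+ j) * (G p * (G M * pow w (j ⊔ k)))
          ≈⟨ solve 5 (λ a b g h e → a :* b :* (g :* (h :* e)) := a :* b :* e :* (g :* h)) refl
               (pow X k) (pow Y (N ℕ.+ j)) (G p) (G M) (pow w (j ⊔ k)) ⟩
        pow X k * pow Y (N ℕ.+ j) * pow w (j ⊔ k) * (G p * G M)
          ≈⟨ *-cong scaling refl ⟩
        normalForm ∎
        where
        tail : sumFromTo (j ⊔ k) N (pow w) ≈ G M * pow w (j ⊔ k)
        tail = trans (reflexive (≡.cong (λ n → sumFromTo (j ⊔ k) n (pow w)) N≡M+[j⊔k]))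
                     (sumFromTo-pow w (j ⊔ k) M)

        Y-exponent : pow Y (N ℕ.+ j) ≈ pow Y K * pow Y (j ⊔ k)
        Y-exponent = trans (pow-≡ Y N+j≡K+[j⊔k]) (pow-distribˡ-+-* Y K (j ⊔ k))

        w-exponent : pow w (j ⊔ k) ≈ pow x k * pow x d * pow y (j ⊔ k)
        w-exponent = trans (pow-distrib-* x y (j ⊔ k))
                           (*-cong (trans (pow-≡ x (m⊔n≡n+[m∸n] j k)) (pow-distribˡ-+-* x k d)) refl)

        scaling : pow X k * pow Y (N ℕ.+ j) * pow w (j ⊔ k) ≈ pow x d * pow Y K
        scaling = begin
          pow X k * pow Y (N ℕ.+ j) * pow w (j ⊔ k)
            ≈⟨ *-cong (*-cong refl Y-exponent) w-exponent ⟩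
          pow X k * (pow Y K * pow Y (j ⊔ k)) * (pow x k * pow x d * pow y (j ⊔ k))
            ≈⟨ solve 6 (λ X Y Y' x x' y → X :* (Y :* Y') :* (x :* x' :* y)
                                          := x' :* Y :* (x :* X :* (y :* Y'))) refl
                 (pow X k) (pow Y K) (pow Y (j ⊔ k)) (pow x k) (pow x d) (pow y (j ⊔ k)) ⟩
          pow x d * pow Y K * (pow x k * pow X k * (pow y (j ⊔ k) * pow Y (j ⊔ k)))
            ≈⟨ *-cong refl (*-cong (pow-inverse k xX≈1) (pow-inverse (j ⊔ k) yY≈1)) ⟩
          pow x d * pow Y K * (1# * 1#)
            ≈⟨ trans (*-cong refl (*-identityʳ 1#)) (*-identityʳ _) ⟩
          pow x d * pow Y K ∎

mainTheorem3 : ∀ {c ℓ : Level} (F : Field c ℓ) →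
    let open Field F
        open FieldOps F
    in (ch : CharZero) →
       (x y : Carrier) (hx : ¬ (x ≈ 0#)) (hy : ¬ (y ≈ 0#)) →
       (s : Carrier) (hs : (s * s) ≈ (x * y)) →
       let s⁻¹ = inv s (sqrt≉0 hx hy hs)
           c₀ = (1# + (x * y)) * inv two (ch 1) * s⁻¹
       in (N j k : ℕ) → 1 ≤ N → j ≤ N → k ≤ N →
          (skewSchur N j k x (inv y hy)
             ≈ (pow (x * s⁻¹) (N ℕ.+ j ∸ k) * U (j ⊓ k) c₀ * U (N ∸ (j ⊔ k)) c₀))
          ×
          (skewSchur N j k x (inv y hy)
             ≈ ((pow (inv x hx) k * pow (inv y hy) (N ℕ.+ j))
                 * (sumTo (j ⊓ k) (pow (x * y)) * sumFromTo (j ⊔ k) N (pow (x * y)))))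
mainTheorem3 F ch x y hx hy s hs N j k _ j≤N k≤N =
    trans skewSchur≈normalForm (sym chebyshevForm≈normalForm)
  , trans skewSchur≈normalForm (sym sumForm≈normalForm)
  where
  open Field F using (trans; sym)
  open Evaluation.AtPoint F ch x y hx hy s hs
  open ForShape j≤N k≤N
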